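{- Let $S$ be a first-order theory with identity satisfying the standing assumptions described in the context, and let $\Theta$ be the sentence $$\forall x\,\exists y\,\mathrm{H}(x,y),$$ where $\mathrm{H}(x,y)$ is a quantifier-free formula of $S$ expressing the primitive recursive relation: "if $x$ is the Gödel number of an $S$-proof of a sentence of the form $\forall u\,\exists v\,A(u,v)$ with $A$ quantifier-free, then $y$ is the Gödel number of an $S$-proof of the sentence $A(\overline{x},\overline{n})$ for some natural number $n$". Suppose $S$ is either inconsistent or $1$-consistent. Then: (i) $\Theta$ is true in the standard natural numbers; (ii) for every natural number $m$, the sentence $\exists y\,\mathrm{H}(\overline{m},y)$ is provable in $S$; (iii) if moreover $S$ is $\omega$-consistent (in fact, $2$-consistency suffices), then $\neg\Theta$ is not provable in $S$. Consequently, if $S$ is $2$-consistent, then $\Theta$ is undecidable in $S$.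
   Context: Language and axioms of $S$: the language contains the constant $0$, the successor symbol, and a function symbol for every primitive recursive function. The axioms include the defining recursion equations of these functions. The set of axioms is primitive recursive, so the proof relation of $S$ is primitive recursive. Numerals and predicates: $\overline{n}=0^{(n)}$ denotes the numeral for $n$. Primitive recursive predicates are represented by quantifier-free formulas. Every true closed quantifier-free sentence of $S$ is provable in $S$. Gödel numbering: a fixed standard Gödel numbering of formulas and proofs is used. In it, the Gödel number of a proof of a formula containing the numeral $\overline{n}$ exceeds $n$. Consistency notions: - $S$ is $1$-consistent if every $\Sigma^0_1$ sentence ($\exists y\,B(y)$ with $B$ quantifier-free) provable in $S$ is true. - $S$ is $2$-consistent if every $\Sigma^0_2$ sentence ($\exists x\,\forall y\,B(x,y)$ with $B$ quantifier-free) provable in $S$ is true. - $S$ is $\omega$-consistent if there is no formula $B(x)$ such that $S$ proves $\exists x\,\neg B(x)$ and also proves $B(\overline{n})$ for every $n$. -}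

module Defs where

open import Data.Nat using (ℕ; zero; suc; _+_; _*_; _^_; _<_)
open import Data.Fin using (Fin; toℕ)
open import Data.Vec using (Vec; []; _∷_; tabulate; map)
open import Data.List using (List; []; _∷_)
open import Data.List.Membership.Propositional using (_∈_)
open import Data.Product using (Σ; _×_; _,_)
open import Data.Unit using (⊤)
open import Data.Empty using (⊥)
open import Relation.Nullary using (¬_)
open import Relation.Binary.PropositionalEquality using (_≡_)

-- Primitive recursive function codes (one function symbol per code)

data PR : ℕ → Set where
  Z   : ∀ n → PR n
  Sc  : PR 1
  P   : ∀ n → Fin n → PR n
  C   : ∀ {m} n → PR m → Vec (PR n) m → PR n
  R   : ∀ {n} → PR n → PR (suc (suc n)) → PR (suc n)

mutual
  eval : ∀ {n} → PR n → Vec ℕ n → ℕ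
  eval (Z n) xs = 0
  eval Sc (x ∷ []) = suc x
  eval (P n i) xs = Data.Vec.lookup xs i
  eval (C n g hs) xs = eval g (evals hs xs)
  eval (R g h) (y ∷ xs) = evalRec g h y xs

  evals : ∀ {n m} → Vec (PR n) m → Vec ℕ n → Vec ℕ m
  evals [] xs = []
  evals (h ∷ hs) xs = eval h xs ∷ evals hs xs

  evalRec : ∀ {n} → PR n → PR (suc (suc n)) → ℕ → Vec ℕ n → ℕ
  evalRec g h zero xs = eval g xs
  evalRec g h (suc y) xs = eval h (y ∷ evalRec g h y xs ∷ xs)

-- Syntax of S (de Bruijn variables; ¬, ⇒, ∀, ∃ and = primitive)

data Term : Set where
  var : ℕ → Term
  zer : Term
  sc  : Term → Term
  app : ∀ {n} → PR n → Vec Term n → Term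

infix 7 _≐_
infixr 5 _⇒_
data Formula : Set where
  _≐_ : Term → Term → Formula
  ¬'  : Formula → Formula
  _⇒_ : Formula → Formula → Formula
  ∀'  : Formula → Formula
  ∃'  : Formula → Formula

num : ℕ → Term
num zero = zer
num (suc n) = sc (num n)

_∷ₛ_ : {A : Set} → A → (ℕ → A) → ℕ → A
(a ∷ₛ σ) zero = a
(a ∷ₛ σ) (suc i) = σ i

mutual
  substT : (ℕ → Term) → Term → Term
  substT σ (var i) = σ i
  substT σ zer = zer
  substT σ (sc t) = sc (substT σ t)
  substT σ (app f ts) = app f (substTs σ ts)

  substTs : ∀ {n} → (ℕ → Term) → Vec Term n → Vec Term n
  substTs σ [] = []
  substTs σ (t ∷ ts) = substT σ t ∷ substTs σ ts

lift : (ℕ → Term) → ℕ → Term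
lift σ zero = var zero
lift σ (suc i) = substT (λ j → var (suc j)) (σ i)

substF : (ℕ → Term) → Formula → Formula
substF σ (s ≐ t) = substT σ s ≐ substT σ t
substF σ (¬' A) = ¬' (substF σ A)
substF σ (A ⇒ B) = substF σ A ⇒ substF σ B
substF σ (∀' A) = ∀' (substF (lift σ) A)
substF σ (∃' A) = ∃' (substF (lift σ) A)

_[_] : Formula → Term → Formula
B [ t ] = substF (t ∷ₛ var) B

wkF : Formula → Formula
wkF = substF (λ j → var (suc j))

-- A(x̄, n̄) for a formula A(u,v) occurring in ∀u ∃v A(u,v)
-- (v is variable 0, u is variable 1)
sub2 : Formula → ℕ → ℕ → Formula
sub2 A x n = substF (num n ∷ₛ (num x ∷ₛ var)) A

mutual
  wsT : ℕ → Term → Set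
  wsT k (var i) = i < k
  wsT k zer = ⊤
  wsT k (sc t) = wsT k t
  wsT k (app f ts) = wsTs k ts

  wsTs : ∀ {n} → ℕ → Vec Term n → Set
  wsTs k [] = ⊤
  wsTs k (t ∷ ts) = wsT k t × wsTs k ts

wsF : ℕ → Formula → Set
wsF k (s ≐ t) = wsT k s × wsT k t
wsF k (¬' A) = wsF k A
wsF k (A ⇒ B) = wsF k A × wsF k B
wsF k (∀' A) = wsF (suc k) A
wsF k (∃' A) = wsF (suc k) A

Sentence : Formula → Set
Sentence = wsF 0

QF : Formula → Set
QF (s ≐ t) = ⊤
QF (¬' A) = QF A
QF (A ⇒ B) = QF A × QF B
QF (∀' A) = ⊥
QF (∃' A) = ⊥

mutual
  ⟦_⟧t : Term → (ℕ → ℕ) → ℕ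
  ⟦ var i ⟧t ρ = ρ i
  ⟦ zer ⟧t ρ = 0
  ⟦ sc t ⟧t ρ = suc (⟦ t ⟧t ρ)
  ⟦ app f ts ⟧t ρ = eval f (⟦ ts ⟧ts ρ)

  ⟦_⟧ts : ∀ {n} → Vec Term n → (ℕ → ℕ) → Vec ℕ n
  ⟦ [] ⟧ts ρ = []
  ⟦ t ∷ ts ⟧ts ρ = ⟦ t ⟧t ρ ∷ ⟦ ts ⟧ts ρ

⟦_⟧ : Formula → (ℕ → ℕ) → Set
⟦ s ≐ t ⟧ ρ = ⟦ s ⟧t ρ ≡ ⟦ t ⟧t ρ
⟦ ¬' A ⟧ ρ = ¬ ⟦ A ⟧ ρ
⟦ A ⇒ B ⟧ ρ = ⟦ A ⟧ ρ → ⟦ B ⟧ ρ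
⟦ ∀' A ⟧ ρ = (d : ℕ) → ⟦ A ⟧ (d ∷ₛ ρ)
⟦ ∃' A ⟧ ρ = Σ ℕ λ d → ⟦ A ⟧ (d ∷ₛ ρ)

TrueN : Formula → Set
TrueN φ = ⟦ φ ⟧ (λ _ → 0)

pair : ℕ → ℕ → ℕ
pair a b = 2 ^ a * (2 * b + 1)

mutual
  ⌜_⌝pr : ∀ {n} → PR n → ℕ
  ⌜ Z n ⌝pr = pair 0 n
  ⌜ Sc ⌝pr = pair 1 0
  ⌜ P n i ⌝pr = pair 2 (pair n (toℕ i))
  ⌜ C n g hs ⌝pr = pair 3 (pair n (pair ⌜ g ⌝pr ⌜ hs ⌝prs))
  ⌜ R g h ⌝pr = pair 4 (pair ⌜ g ⌝pr ⌜ h ⌝pr)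

  ⌜_⌝prs : ∀ {n m} → Vec (PR n) m → ℕ
  ⌜ [] ⌝prs = 0
  ⌜ h ∷ hs ⌝prs = pair ⌜ h ⌝pr ⌜ hs ⌝prs

mutual
  ⌜_⌝t : Term → ℕ
  ⌜ var i ⌝t = pair 0 i
  ⌜ zer ⌝t = pair 1 0
  ⌜ sc t ⌝t = pair 2 ⌜ t ⌝t
  ⌜ app f ts ⌝t = pair 3 (pair ⌜ f ⌝pr ⌜ ts ⌝ts)

  ⌜_⌝ts : ∀ {n} → Vec Term n → ℕ
  ⌜ [] ⌝ts = 0
  ⌜ t ∷ ts ⌝ts = pair ⌜ t ⌝t ⌜ ts ⌝ts

⌜_⌝ : Formula → ℕ
⌜ s ≐ t ⌝ = pair 0 (pair ⌜ s ⌝t ⌜ t ⌝t)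
⌜ ¬' A ⌝ = pair 1 ⌜ A ⌝
⌜ A ⇒ B ⌝ = pair 2 (pair ⌜ A ⌝ ⌜ B ⌝)
⌜ ∀' A ⌝ = pair 3 ⌜ A ⌝
⌜ ∃' A ⌝ = pair 4 ⌜ A ⌝

⌜_⌝l : List Formula → ℕ
⌜ [] ⌝l = 0
⌜ φ ∷ ps ⌝l = pair ⌜ φ ⌝ ⌜ ps ⌝l

vs : ∀ n → Vec Term n
vs n = tabulate (λ i → var (toℕ i))

data RecEq : ∀ {n} → PR n → Formula → Set where
  eqZ  : ∀ n → RecEq (Z n) (app (Z n) (vs n) ≐ zer)
  eqSc : RecEq Sc (app Sc (var 0 ∷ []) ≐ sc (var 0))
  eqP  : ∀ n (i : Fin n) → RecEq (P n i) (app (P n i) (vs n) ≐ var (toℕ i))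
  eqC  : ∀ {m} n (g : PR m) (hs : Vec (PR n) m) →
         RecEq (C n g hs) (app (C n g hs) (vs n) ≐ app g (map (λ h → app h (vs n)) hs))
  eqR0 : ∀ {n} (g : PR n) (h : PR (suc (suc n))) →
         RecEq (R g h) (app (R g h) (zer ∷ vs n) ≐ app g (vs n))
  eqRS : ∀ {n} (g : PR n) (h : PR (suc (suc n))) →
         RecEq (R g h) (app (R g h) (sc (var n) ∷ vs n)
                        ≐ app h (var n ∷ app (R g h) (var n ∷ vs n) ∷ vs n))

-- First-order logic with identity (Hilbert system, Mendelson style)

data LogAx : Formula → Set where
  ax1 : ∀ B C → LogAx (B ⇒ (C ⇒ B))
  ax2 : ∀ B C D → LogAx ((B ⇒ (C ⇒ D)) ⇒ ((B ⇒ C) ⇒ (B ⇒ D)))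
  ax3 : ∀ B C → LogAx ((¬' C ⇒ ¬' B) ⇒ ((¬' C ⇒ B) ⇒ C))
  ax4 : ∀ B t → LogAx (∀' B ⇒ B [ t ])
  ax5 : ∀ B C → LogAx (∀' (wkF B ⇒ C) ⇒ (B ⇒ ∀' C))
  ax6 : ∀ B t → LogAx (B [ t ] ⇒ ∃' B)
  ax7 : ∀ B C → LogAx (∀' (B ⇒ wkF C) ⇒ (∃' B ⇒ C))
  eq1 : ∀ t → LogAx (t ≐ t)
  eq2 : ∀ B s t → LogAx ((s ≐ t) ⇒ (B [ s ] ⇒ B [ t ]))

-- A theory S in this language: a primitive recursive set of axioms
-- containing the defining recursion equations.
record Theory : Set₁ where
  field
    Ax    : Formula → Set
    axPR  : Σ (PR 1) λ χ → (φ : Formula) →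
              (Ax φ → eval χ (⌜ φ ⌝ ∷ []) ≡ 0) × (eval χ (⌜ φ ⌝ ∷ []) ≡ 0 → Ax φ)
    recAx : ∀ {n} (f : PR n) (φ : Formula) → RecEq f φ → Ax φ

module _ (S : Theory) where
  open Theory S

  -- one step of a proof; 'prev' = earlier lines (most recent first)
  data Step (prev : List Formula) (φ : Formula) : Set where
    logical : LogAx φ → Step prev φ
    axiom   : Ax φ → Step prev φ
    mp      : (ψ : Formula) → ψ ∈ prev → (ψ ⇒ φ) ∈ prev → Step prev φ
    gen     : (ψ : Formula) → φ ≡ ∀' ψ → ψ ∈ prev → Step prev φ

  -- a proof is stored as a list with its last line first
  Valid : List Formula → Set
  Valid [] = ⊤
  Valid (φ ∷ ps) = Step ps φ × Valid ps

  PrfS : ℕ → Formula → Set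
  PrfS x φ = Σ (List Formula) λ ps → Valid (φ ∷ ps) × (⌜ φ ∷ ps ⌝l ≡ x)

  Prov : Formula → Set
  Prov φ = Σ ℕ λ x → PrfS x φ

  Inconsistent : Set
  Inconsistent = Σ Formula λ φ → Prov φ × Prov (¬' φ)

  OneConsistent : Set
  OneConsistent = (B : Formula) → QF B → wsF 1 B → Prov (∃' B) → TrueN (∃' B)

  TwoConsistent : Set
  TwoConsistent = (B : Formula) → QF B → wsF 2 B → Prov (∃' (∀' B)) → TrueN (∃' (∀' B))

  OmegaConsistent : Set
  OmegaConsistent = (B : Formula) → wsF 1 B →
                    ¬ (Prov (∃' (¬' B)) × ((n : ℕ) → Prov (B [ num n ])))

  QFComplete : Set
  QFComplete = (φ : Formula) → QF φ → Sentence φ → TrueN φ → Prov φ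

  HRel : ℕ → ℕ → Set
  HRel x y = (A : Formula) → QF A → wsF 2 A → PrfS x (∀' (∃' A)) →
             Σ ℕ λ n → PrfS y (sub2 A x n)

  -- H(x,y) (x = variable 1, y = variable 0) is a quantifier-free formula expressing HRel
  Expresses : Formula → Set
  Expresses H = QF H × wsF 2 H ×
                ((x y : ℕ) → (TrueN (sub2 H x y) → HRel x y) × (HRel x y → TrueN (sub2 H x y)))

Θ : Formula → Formula
Θ H = ∀' (∃' H)

∃H : Formula → ℕ → Formula
∃H H m = ∃' (substF (var 0 ∷ₛ (num m ∷ₛ (λ j → var (suc j)))) H)

-- Whether x codes an S-proof of some ∀u ∃v A(u, v) is decidable: decode x and check
-- it line by line, which works because a formula determines the one instance of each
-- logical axiom schema it could be. If it is such a proof, 1-consistency makes some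
-- A(x̄, n̄) true, hence provable by QF completeness (if S is inconsistent it is provable
-- anyway), and the code of that proof is a y with H(x, y); otherwise every y is. This
-- gives (i), and (ii) by QF completeness. A proof of ¬Θ yields proofs of ∃x ¬∃y H,
-- excluded by (ii) under ω-consistency, and of the Σ₂ sentence ∃x ∀y ¬H, false by (i).
-- If x codes a proof of Θ itself, every y with H(x, y) codes a proof of a true instance
-- H(x̄, n̄), and n < y since the numeral n̄ occurs in it (or n can be replaced by 0):
-- an infinite descent.

module Submission where

open import Data.Empty using (⊥-elim)
open import Data.Fin using (Fin; toℕ; fromℕ<)
open import Data.Fin.Properties using (toℕ<n; fromℕ<-toℕ)
open import Data.List using (List; []; _∷_; _++_)
open import Data.List.Membership.Propositional using (_∈_; find; lose)
open import Data.List.Membership.Propositional.Properties using (∈-++⁺ˡ; ∈-++⁺ʳ)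
open import Data.List.Relation.Unary.Any using (Any; here; there; any?; satisfied)
open import Data.Maybe as Maybe using (Maybe; just; nothing; _>>=_; _<∣>_; fromMaybe)
open import Data.Maybe.Properties using (just-injective)
open import Data.Nat using (ℕ; zero; suc; _+_; _*_; _^_; _<_; _≤_; z≤n; s≤s; ⌊_/2⌋; >-nonZero; pred; parity)
open import Data.Nat.Induction using (<-wellFounded)
open import Data.Nat.Properties
open import Data.Parity.Base using (0ℙ; 1ℙ)
open import Data.Product as Product using (Σ; _×_; _,_; proj₁; proj₂; map₁; map₂)
open import Data.Sum as Sum using (_⊎_; inj₁; inj₂; [_,_]′; fromInj₂)
open import Data.Unit using (tt)
open import Data.Vec using (Vec; []; _∷_)
open import Function.Base using (_∘_; case_of_)
open import Function.Bundles using (_⇔_; mk⇔; Equivalence)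
open import Induction.InfiniteDescent using (Descent; descent∧wf⇒empty)
open import Relation.Binary.Definitions using (DecidableEquality)
open import Relation.Binary.PropositionalEquality hiding ([_])
open import Relation.Nullary using (Dec; yes; no; ¬_)
open import Relation.Nullary.Decidable using (map′; _×-dec_; _⊎-dec_)

open import Defs

-- Decoding Gödel numbers

parity-n+n : ∀ n → parity (n + n) ≡ 0ℙ
parity-n+n zero = refl
parity-n+n (suc n) rewrite +-suc n n = parity-n+n n

parity-1+n+n : ∀ n → parity (suc (n + n)) ≡ 1ℙ
parity-1+n+n zero = refl
parity-1+n+n (suc n) rewrite +-suc n n = parity-1+n+n n

⌊1+n+n/2⌋≡n : ∀ n → ⌊ suc (n + n) /2⌋ ≡ n
⌊1+n+n/2⌋≡n zero = refl
⌊1+n+n/2⌋≡n (suc n) rewrite +-suc n n = cong suc (⌊1+n+n/2⌋≡n n)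

pair-zero : ∀ b → pair 0 b ≡ suc (b + b)
pair-zero b = begin
  1 * (2 * b + 1)   ≡⟨ *-identityˡ _ ⟩
  2 * b + 1         ≡⟨ +-comm (2 * b) 1 ⟩
  suc (b + (b + 0)) ≡⟨ cong (λ m → suc (b + m)) (+-identityʳ b) ⟩
  suc (b + b)       ∎
  where open ≡-Reasoning

pair-suc : ∀ a b → pair (suc a) b ≡ pair a b + pair a b
pair-suc a b = begin
  2 * 2 ^ a * (2 * b + 1)     ≡⟨ *-assoc 2 (2 ^ a) _ ⟩
  pair a b + (pair a b + 0)   ≡⟨ cong (pair a b +_) (+-identityʳ _) ⟩
  pair a b + pair a b         ∎
  where open ≡-Reasoning

unpairWithin : ℕ → ℕ → ℕ × ℕ
unpairWithin zero x = 0 , 0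
unpairWithin (suc fuel) x with parity x
... | 0ℙ = map₁ suc (unpairWithin fuel ⌊ x /2⌋)
... | 1ℙ = 0 , ⌊ x /2⌋

unpair : ℕ → ℕ × ℕ
unpair x = unpairWithin x x

unpairWithin-pair : ∀ fuel a b → a < fuel → unpairWithin fuel (pair a b) ≡ (a , b)
unpairWithin-pair (suc fuel) zero b _
  rewrite pair-zero b | parity-1+n+n b = cong (0 ,_) (⌊1+n+n/2⌋≡n b)
unpairWithin-pair (suc fuel) (suc a) b (s≤s a<fuel)
  rewrite pair-suc a b | parity-n+n (pair a b) | sym (n≡⌊n+n/2⌋ (pair a b))
  = cong (map₁ suc) (unpairWithin-pair fuel a b a<fuel)

a<2^a : ∀ a → a < 2 ^ a
a<2^a zero = s≤s z≤n
a<2^a (suc a) = begin-strict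
  suc a             ≤⟨ a<2^a a ⟩
  2 ^ a             <⟨ m<m+n (2 ^ a) (m^n>0 2 a) ⟩
  2 ^ a + 2 ^ a     ≡⟨ cong (2 ^ a +_) (sym (+-identityʳ (2 ^ a))) ⟩
  2 ^ suc a         ∎
  where open ≤-Reasoning

fst<pair : ∀ a b → a < pair a b
fst<pair a b = begin-strict
  a                   <⟨ a<2^a a ⟩
  2 ^ a               ≡⟨ *-identityʳ (2 ^ a) ⟨
  2 ^ a * 1           ≤⟨ *-monoʳ-≤ (2 ^ a) (m≤n+m 1 (2 * b)) ⟩
  pair a b            ∎
  where open ≤-Reasoning

snd<pair : ∀ a b → b < pair a b
snd<pair a b = begin-strict
  b                   <⟨ s≤s (m≤m+n b (b + 0)) ⟩
  suc (2 * b)         ≡⟨ +-comm 1 (2 * b) ⟩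
  2 * b + 1           ≤⟨ m≤n*m (2 * b + 1) (2 ^ a) {{>-nonZero (m^n>0 2 a)}} ⟩
  pair a b            ∎
  where open ≤-Reasoning

0<pair : ∀ a b → 0 < pair a b
0<pair a b = ≤-<-trans z≤n (fst<pair a b)

unpair-pair : ∀ a b → unpair (pair a b) ≡ (a , b)
unpair-pair a b = unpairWithin-pair (pair a b) a b (fst<pair a b)

pair-mono-≤ : ∀ {a a′ b b′} → a ≤ a′ → b ≤ b′ → pair a b ≤ pair a′ b′
pair-mono-≤ a≤a′ b≤b′ = *-mono-≤ (^-monoʳ-≤ 2 a≤a′) (+-monoˡ-≤ 1 (*-monoʳ-≤ 2 b≤b′))

withArity : (n : ℕ) → Σ ℕ PR → Maybe (PR n)
withArity n (m , g) with m ≟ n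
... | yes refl = just g
... | no _ = nothing

withArity-refl : ∀ {n} (g : PR n) → withArity n (n , g) ≡ just g
withArity-refl {n} g rewrite ≟-diag (refl {x = n}) = refl

projection : ℕ → ℕ → Maybe (Σ ℕ PR)
projection n i with i <? n
... | yes i<n = just (n , P n (fromℕ< i<n))
... | no _ = nothing

projection-toℕ : ∀ n (i : Fin n) → projection n (toℕ i) ≡ just (n , P n i)
projection-toℕ n i with toℕ i <? n
... | yes i<n = cong (λ j → just (n , P n j)) (fromℕ<-toℕ i i<n)
... | no i≮n = ⊥-elim (i≮n (toℕ<n i))

mutual
  decodePR : ℕ → ℕ → Maybe (Σ ℕ PR)
  decodePR zero _ = nothing
  decodePR (suc fuel) x = decodePRWith fuel (unpair x)

  decodePRWith : ℕ → ℕ × ℕ → Maybe (Σ ℕ PR)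
  decodePRWith fuel (0 , n) = just (n , Z n)
  decodePRWith fuel (1 , _) = just (1 , Sc)
  decodePRWith fuel (2 , r) = let (n , i) = unpair r in projection n i
  decodePRWith fuel (3 , r) =
    let (n , r') = unpair r ; (cg , chs) = unpair r' in
    decodePR fuel cg >>= λ (m , g) →
    decodePRs fuel n m chs >>= λ hs → just (n , C n g hs)
  decodePRWith fuel (4 , r) =
    let (cg , ch) = unpair r in
    decodePR fuel cg >>= λ (n , g) →
    decodePR fuel ch >>= withArity (suc (suc n)) >>= λ h → just (suc n , R g h)
  decodePRWith fuel _ = nothing

  decodePRs : ℕ → (n m : ℕ) → ℕ → Maybe (Vec (PR n) m)
  decodePRs fuel n zero x = just []
  decodePRs zero n (suc m) x = nothing
  decodePRs (suc fuel) n (suc m) x =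
    let (ch , chs) = unpair x in
    decodePR fuel ch >>= withArity n >>= λ h →
    decodePRs fuel n m chs >>= λ hs → just (h ∷ hs)

fuel-fst : ∀ a b {fuel} → pair a b < suc fuel → a < fuel
fuel-fst a b (s≤s p) = <-≤-trans (fst<pair a b) p

fuel-snd : ∀ a b {fuel} → pair a b < suc fuel → b < fuel
fuel-snd a b (s≤s p) = <-≤-trans (snd<pair a b) p

ghs<fuel : ∀ {m} n (g : PR m) (hs : Vec (PR n) m) {fuel} →
           ⌜ C n g hs ⌝pr < suc fuel → pair ⌜ g ⌝pr ⌜ hs ⌝prs < fuel
ghs<fuel n g hs lt = <-trans (snd<pair n _) (fuel-snd 3 (pair n (pair ⌜ g ⌝pr ⌜ hs ⌝prs)) lt)

mutual
  decodePR-⌜⌝ : ∀ {n} (g : PR n) fuel → ⌜ g ⌝pr < fuel → decodePR fuel ⌜ g ⌝pr ≡ just (n , g)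
  decodePR-⌜⌝ (Z n) (suc fuel) _ rewrite unpair-pair 0 n = refl
  decodePR-⌜⌝ Sc (suc fuel) _ rewrite unpair-pair 1 0 = refl
  decodePR-⌜⌝ (P n i) (suc fuel) _
    rewrite unpair-pair 2 (pair n (toℕ i)) | unpair-pair n (toℕ i) = projection-toℕ n i
  decodePR-⌜⌝ (C n g hs) (suc fuel) lt
    rewrite unpair-pair 3 (pair n (pair ⌜ g ⌝pr ⌜ hs ⌝prs)) | unpair-pair n (pair ⌜ g ⌝pr ⌜ hs ⌝prs)
          | unpair-pair ⌜ g ⌝pr ⌜ hs ⌝prs
          | decodePR-⌜⌝ g fuel (<-trans (fst<pair ⌜ g ⌝pr ⌜ hs ⌝prs) (ghs<fuel n g hs lt))
          | decodePRs-⌜⌝ hs fuel (<-trans (snd<pair ⌜ g ⌝pr ⌜ hs ⌝prs) (ghs<fuel n g hs lt))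
          = refl
  decodePR-⌜⌝ (R g h) (suc fuel) lt
    rewrite unpair-pair 4 (pair ⌜ g ⌝pr ⌜ h ⌝pr) | unpair-pair ⌜ g ⌝pr ⌜ h ⌝pr
          | decodePR-⌜⌝ g fuel (<-trans (fst<pair ⌜ g ⌝pr ⌜ h ⌝pr) (fuel-snd 4 _ lt))
          | decodePR-⌜⌝ h fuel (<-trans (snd<pair ⌜ g ⌝pr ⌜ h ⌝pr) (fuel-snd 4 _ lt))
          | withArity-refl h = refl

  decodePRs-⌜⌝ : ∀ {n m} (hs : Vec (PR n) m) fuel → ⌜ hs ⌝prs < fuel →
                 decodePRs fuel n m ⌜ hs ⌝prs ≡ just hs
  decodePRs-⌜⌝ [] fuel _ = refl
  decodePRs-⌜⌝ (h ∷ hs) (suc fuel) lt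
    rewrite unpair-pair ⌜ h ⌝pr ⌜ hs ⌝prs
          | decodePR-⌜⌝ h fuel (fuel-fst ⌜ h ⌝pr ⌜ hs ⌝prs lt) | withArity-refl h
          | decodePRs-⌜⌝ hs fuel (fuel-snd ⌜ h ⌝pr ⌜ hs ⌝prs lt) = refl

mutual
  decodeT : ℕ → ℕ → Maybe Term
  decodeT zero _ = nothing
  decodeT (suc fuel) x = decodeTWith fuel (unpair x)

  decodeTWith : ℕ → ℕ × ℕ → Maybe Term
  decodeTWith fuel (0 , i) = just (var i)
  decodeTWith fuel (1 , _) = just zer
  decodeTWith fuel (2 , r) = Maybe.map sc (decodeT fuel r)
  decodeTWith fuel (3 , r) =
    let (cf , cts) = unpair r in
    decodePR fuel cf >>= λ (n , f) → Maybe.map (app f) (decodeTs fuel n cts)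
  decodeTWith fuel _ = nothing

  decodeTs : ℕ → (n : ℕ) → ℕ → Maybe (Vec Term n)
  decodeTs fuel zero x = just []
  decodeTs zero (suc n) x = nothing
  decodeTs (suc fuel) (suc n) x =
    let (ct , cts) = unpair x in
    decodeT fuel ct >>= λ t → Maybe.map (t ∷_) (decodeTs fuel n cts)

mutual
  decodeT-⌜⌝ : ∀ t fuel → ⌜ t ⌝t < fuel → decodeT fuel ⌜ t ⌝t ≡ just t
  decodeT-⌜⌝ (var i) (suc fuel) _ rewrite unpair-pair 0 i = refl
  decodeT-⌜⌝ zer (suc fuel) _ rewrite unpair-pair 1 0 = refl
  decodeT-⌜⌝ (sc t) (suc fuel) lt
    rewrite unpair-pair 2 ⌜ t ⌝t | decodeT-⌜⌝ t fuel (fuel-snd 2 ⌜ t ⌝t lt) = refl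
  decodeT-⌜⌝ (app f ts) (suc fuel) lt
    rewrite unpair-pair 3 (pair ⌜ f ⌝pr ⌜ ts ⌝ts) | unpair-pair ⌜ f ⌝pr ⌜ ts ⌝ts
          | decodePR-⌜⌝ f fuel (<-trans (fst<pair ⌜ f ⌝pr ⌜ ts ⌝ts) (fuel-snd 3 _ lt))
          | decodeTs-⌜⌝ ts fuel (<-trans (snd<pair ⌜ f ⌝pr ⌜ ts ⌝ts) (fuel-snd 3 _ lt)) = refl

  decodeTs-⌜⌝ : ∀ {n} (ts : Vec Term n) fuel → ⌜ ts ⌝ts < fuel → decodeTs fuel n ⌜ ts ⌝ts ≡ just ts
  decodeTs-⌜⌝ [] fuel _ = refl
  decodeTs-⌜⌝ (t ∷ ts) (suc fuel) lt
    rewrite unpair-pair ⌜ t ⌝t ⌜ ts ⌝ts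
          | decodeT-⌜⌝ t fuel (fuel-fst ⌜ t ⌝t ⌜ ts ⌝ts lt)
          | decodeTs-⌜⌝ ts fuel (fuel-snd ⌜ t ⌝t ⌜ ts ⌝ts lt) = refl

decodeF : ℕ → ℕ → Maybe Formula
decodeFWith : ℕ → ℕ × ℕ → Maybe Formula
decodeF zero _ = nothing
decodeF (suc fuel) x = decodeFWith fuel (unpair x)
decodeFWith fuel (0 , r) =
  let (cs , ct) = unpair r in
  decodeT fuel cs >>= λ s → Maybe.map (s ≐_) (decodeT fuel ct)
decodeFWith fuel (1 , r) = Maybe.map ¬' (decodeF fuel r)
decodeFWith fuel (2 , r) =
  let (cA , cB) = unpair r in
  decodeF fuel cA >>= λ A → Maybe.map (A ⇒_) (decodeF fuel cB)
decodeFWith fuel (3 , r) = Maybe.map ∀' (decodeF fuel r)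
decodeFWith fuel (4 , r) = Maybe.map ∃' (decodeF fuel r)
decodeFWith fuel _ = nothing

decodeF-⌜⌝ : ∀ A fuel → ⌜ A ⌝ < fuel → decodeF fuel ⌜ A ⌝ ≡ just A
decodeF-⌜⌝ (s ≐ t) (suc fuel) lt
  rewrite unpair-pair 0 (pair ⌜ s ⌝t ⌜ t ⌝t) | unpair-pair ⌜ s ⌝t ⌜ t ⌝t
        | decodeT-⌜⌝ s fuel (<-trans (fst<pair ⌜ s ⌝t ⌜ t ⌝t) (fuel-snd 0 _ lt))
        | decodeT-⌜⌝ t fuel (<-trans (snd<pair ⌜ s ⌝t ⌜ t ⌝t) (fuel-snd 0 _ lt)) = refl
decodeF-⌜⌝ (¬' A) (suc fuel) lt
  rewrite unpair-pair 1 ⌜ A ⌝ | decodeF-⌜⌝ A fuel (fuel-snd 1 ⌜ A ⌝ lt) = refl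
decodeF-⌜⌝ (A ⇒ B) (suc fuel) lt
  rewrite unpair-pair 2 (pair ⌜ A ⌝ ⌜ B ⌝) | unpair-pair ⌜ A ⌝ ⌜ B ⌝
        | decodeF-⌜⌝ A fuel (<-trans (fst<pair ⌜ A ⌝ ⌜ B ⌝) (fuel-snd 2 _ lt))
        | decodeF-⌜⌝ B fuel (<-trans (snd<pair ⌜ A ⌝ ⌜ B ⌝) (fuel-snd 2 _ lt)) = refl
decodeF-⌜⌝ (∀' A) (suc fuel) lt
  rewrite unpair-pair 3 ⌜ A ⌝ | decodeF-⌜⌝ A fuel (fuel-snd 3 ⌜ A ⌝ lt) = refl
decodeF-⌜⌝ (∃' A) (suc fuel) lt
  rewrite unpair-pair 4 ⌜ A ⌝ | decodeF-⌜⌝ A fuel (fuel-snd 4 ⌜ A ⌝ lt) = refl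

decodeL : ℕ → ℕ → Maybe (List Formula)
decodeL zero _ = nothing
decodeL (suc fuel) x with x ≟ 0
... | yes _ = just []
... | no _ = let (cφ , cps) = unpair x in
             decodeF fuel cφ >>= λ φ → Maybe.map (φ ∷_) (decodeL fuel cps)

decodeL-⌜⌝ : ∀ ps fuel → ⌜ ps ⌝l < fuel → decodeL fuel ⌜ ps ⌝l ≡ just ps
decodeL-⌜⌝ [] (suc fuel) _ = refl
decodeL-⌜⌝ (φ ∷ ps) (suc fuel) lt with pair ⌜ φ ⌝ ⌜ ps ⌝l ≟ 0
... | yes code≡0 = ⊥-elim (<⇒≢ (0<pair ⌜ φ ⌝ ⌜ ps ⌝l) (sym code≡0))
... | no _ rewrite unpair-pair ⌜ φ ⌝ ⌜ ps ⌝l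
                | decodeF-⌜⌝ φ fuel (fuel-fst ⌜ φ ⌝ ⌜ ps ⌝l lt)
                | decodeL-⌜⌝ ps fuel (fuel-snd ⌜ φ ⌝ ⌜ ps ⌝l lt) = refl

decode : ℕ → Maybe (List Formula)
decode x = decodeL (suc x) x

decode-⌜⌝ : ∀ ps → decode ⌜ ps ⌝l ≡ just ps
decode-⌜⌝ ps = decodeL-⌜⌝ ps (suc ⌜ ps ⌝l) ≤-refl

≡-dec-by-decoding : {A : Set} (code : A → ℕ) (decodeWithin : ℕ → ℕ → Maybe A) →
                    (∀ a → decodeWithin (suc (code a)) (code a) ≡ just a) → DecidableEquality A
≡-dec-by-decoding code decodeWithin retract x y = map′ injective (cong code) (code x ≟ code y)
  where
  injective : code x ≡ code y → x ≡ y
  injective e = just-injective (begin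
    just x                                      ≡⟨ retract x ⟨
    decodeWithin (suc (code x)) (code x)        ≡⟨ cong (λ c → decodeWithin (suc c) c) e ⟩
    decodeWithin (suc (code y)) (code y)        ≡⟨ retract y ⟩
    just y                                      ∎)
    where open ≡-Reasoning

_≟ₜ_ : DecidableEquality Term
_≟ₜ_ = ≡-dec-by-decoding ⌜_⌝t decodeT (λ t → decodeT-⌜⌝ t _ ≤-refl)

_≟F_ : DecidableEquality Formula
_≟F_ = ≡-dec-by-decoding ⌜_⌝ decodeF (λ A → decodeF-⌜⌝ A _ ≤-refl)

-- Substitution

Sub : Set
Sub = ℕ → Term

wkT : Term → Term
wkT = substT (λ j → var (suc j))

_∘ₛ_ : Sub → Sub → Sub
(σ ∘ₛ τ) i = substT σ (τ i)

mutual
  substT-cong : ∀ {σ τ : Sub} → (∀ i → σ i ≡ τ i) → ∀ t → substT σ t ≡ substT τ t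
  substT-cong e (var i) = e i
  substT-cong e zer = refl
  substT-cong e (sc t) = cong sc (substT-cong e t)
  substT-cong e (app f ts) = cong (app f) (substTs-cong e ts)

  substTs-cong : ∀ {σ τ : Sub} → (∀ i → σ i ≡ τ i) → ∀ {n} (ts : Vec Term n) →
                 substTs σ ts ≡ substTs τ ts
  substTs-cong e [] = refl
  substTs-cong e (t ∷ ts) = cong₂ _∷_ (substT-cong e t) (substTs-cong e ts)

mutual
  substT-∘ : ∀ (σ τ : Sub) t → substT σ (substT τ t) ≡ substT (σ ∘ₛ τ) t
  substT-∘ σ τ (var i) = refl
  substT-∘ σ τ zer = refl
  substT-∘ σ τ (sc t) = cong sc (substT-∘ σ τ t)
  substT-∘ σ τ (app f ts) = cong (app f) (substTs-∘ σ τ ts)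

  substTs-∘ : ∀ (σ τ : Sub) {n} (ts : Vec Term n) →
              substTs σ (substTs τ ts) ≡ substTs (σ ∘ₛ τ) ts
  substTs-∘ σ τ [] = refl
  substTs-∘ σ τ (t ∷ ts) = cong₂ _∷_ (substT-∘ σ τ t) (substTs-∘ σ τ ts)

lift-cong : ∀ {σ τ : Sub} → (∀ i → σ i ≡ τ i) → ∀ i → lift σ i ≡ lift τ i
lift-cong e zero = refl
lift-cong e (suc i) = cong wkT (e i)

substF-cong : ∀ {σ τ : Sub} → (∀ i → σ i ≡ τ i) → ∀ A → substF σ A ≡ substF τ A
substF-cong e (s ≐ t) = cong₂ _≐_ (substT-cong e s) (substT-cong e t)
substF-cong e (¬' A) = cong ¬' (substF-cong e A)
substF-cong e (A ⇒ B) = cong₂ _⇒_ (substF-cong e A) (substF-cong e B)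
substF-cong e (∀' A) = cong ∀' (substF-cong (lift-cong e) A)
substF-cong e (∃' A) = cong ∃' (substF-cong (lift-cong e) A)

lift-∘ : ∀ (σ τ : Sub) i → (lift σ ∘ₛ lift τ) i ≡ lift (σ ∘ₛ τ) i
lift-∘ σ τ zero = refl
lift-∘ σ τ (suc i) = trans (substT-∘ (lift σ) (λ j → var (suc j)) (τ i))
                           (sym (substT-∘ (λ j → var (suc j)) σ (τ i)))

substF-∘ : ∀ (σ τ : Sub) A → substF σ (substF τ A) ≡ substF (σ ∘ₛ τ) A
substF-∘ σ τ (s ≐ t) = cong₂ _≐_ (substT-∘ σ τ s) (substT-∘ σ τ t)
substF-∘ σ τ (¬' A) = cong ¬' (substF-∘ σ τ A)
substF-∘ σ τ (A ⇒ B) = cong₂ _⇒_ (substF-∘ σ τ A) (substF-∘ σ τ B)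
substF-∘ σ τ (∀' A) = cong ∀' (trans (substF-∘ (lift σ) (lift τ) A) (substF-cong (lift-∘ σ τ) A))
substF-∘ σ τ (∃' A) = cong ∃' (trans (substF-∘ (lift σ) (lift τ) A) (substF-cong (lift-∘ σ τ) A))

lift-var : ∀ i → lift var i ≡ var i
lift-var zero = refl
lift-var (suc i) = refl

mutual
  substT-var : ∀ t → substT var t ≡ t
  substT-var (var i) = refl
  substT-var zer = refl
  substT-var (sc t) = cong sc (substT-var t)
  substT-var (app f ts) = cong (app f) (substTs-var ts)

  substTs-var : ∀ {n} (ts : Vec Term n) → substTs var ts ≡ ts
  substTs-var [] = refl
  substTs-var (t ∷ ts) = cong₂ _∷_ (substT-var t) (substTs-var ts)

substF-var : ∀ A → substF var A ≡ A
substF-var (s ≐ t) = cong₂ _≐_ (substT-var s) (substT-var t)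
substF-var (¬' A) = cong ¬' (substF-var A)
substF-var (A ⇒ B) = cong₂ _⇒_ (substF-var A) (substF-var B)
substF-var (∀' A) = cong ∀' (trans (substF-cong lift-var A) (substF-var A))
substF-var (∃' A) = cong ∃' (trans (substF-cong lift-var A) (substF-var A))

IdBelow : ℕ → Sub → Set
IdBelow k σ = ∀ i → i < k → σ i ≡ var i

lift-idBelow : ∀ {σ} k → IdBelow k σ → IdBelow (suc k) (lift σ)
lift-idBelow k id zero _ = refl
lift-idBelow k id (suc i) (s≤s i<k) = cong wkT (id i i<k)

mutual
  substT-idBelow : ∀ {σ} k → IdBelow k σ → ∀ t → wsT k t → substT σ t ≡ t
  substT-idBelow k id (var i) i<k = id i i<k
  substT-idBelow k id zer _ = refl
  substT-idBelow k id (sc t) w = cong sc (substT-idBelow k id t w)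
  substT-idBelow k id (app f ts) w = cong (app f) (substTs-idBelow k id ts w)

  substTs-idBelow : ∀ {σ} k → IdBelow k σ → ∀ {n} (ts : Vec Term n) → wsTs k ts → substTs σ ts ≡ ts
  substTs-idBelow k id [] _ = refl
  substTs-idBelow k id (t ∷ ts) (w , ws) = cong₂ _∷_ (substT-idBelow k id t w) (substTs-idBelow k id ts ws)

substF-idBelow : ∀ {σ} k → IdBelow k σ → ∀ A → wsF k A → substF σ A ≡ A
substF-idBelow k id (s ≐ t) (ws , wt) = cong₂ _≐_ (substT-idBelow k id s ws) (substT-idBelow k id t wt)
substF-idBelow k id (¬' A) w = cong ¬' (substF-idBelow k id A w)
substF-idBelow k id (A ⇒ B) (wA , wB) = cong₂ _⇒_ (substF-idBelow k id A wA) (substF-idBelow k id B wB)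
substF-idBelow k id (∀' A) w = cong ∀' (substF-idBelow (suc k) (lift-idBelow k id) A w)
substF-idBelow k id (∃' A) w = cong ∃' (substF-idBelow (suc k) (lift-idBelow k id) A w)

wkF-sentence : ∀ A → Sentence A → wkF A ≡ A
wkF-sentence = substF-idBelow 0 (λ _ ())

ScopedBelow : ℕ → ℕ → Sub → Set
ScopedBelow k m σ = ∀ i → i < k → wsT m (σ i)

mutual
  substT-ws : ∀ {σ} k m → ScopedBelow k m σ → ∀ t → wsT k t → wsT m (substT σ t)
  substT-ws k m sσ (var i) i<k = sσ i i<k
  substT-ws k m sσ zer _ = tt
  substT-ws k m sσ (sc t) w = substT-ws k m sσ t w
  substT-ws k m sσ (app f ts) w = substTs-ws k m sσ ts w

  substTs-ws : ∀ {σ} k m → ScopedBelow k m σ → ∀ {n} (ts : Vec Term n) → wsTs k ts → wsTs m (substTs σ ts)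
  substTs-ws k m sσ [] _ = tt
  substTs-ws k m sσ (t ∷ ts) (w , ws) = substT-ws k m sσ t w , substTs-ws k m sσ ts ws

wkT-ws : ∀ m t → wsT m t → wsT (suc m) (wkT t)
wkT-ws m = substT-ws m (suc m) (λ _ i<m → s≤s i<m)

lift-ws : ∀ {σ} k m → ScopedBelow k m σ → ScopedBelow (suc k) (suc m) (lift σ)
lift-ws k m sσ zero _ = s≤s z≤n
lift-ws {σ} k m sσ (suc i) (s≤s i<k) = wkT-ws m (σ i) (sσ i i<k)

substF-ws : ∀ {σ} k m → ScopedBelow k m σ → ∀ A → wsF k A → wsF m (substF σ A)
substF-ws k m sσ (s ≐ t) (ws , wt) = substT-ws k m sσ s ws , substT-ws k m sσ t wt
substF-ws k m sσ (¬' A) w = substF-ws k m sσ A w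
substF-ws k m sσ (A ⇒ B) (wA , wB) = substF-ws k m sσ A wA , substF-ws k m sσ B wB
substF-ws k m sσ (∀' A) w = substF-ws (suc k) (suc m) (lift-ws k m sσ) A w
substF-ws k m sσ (∃' A) w = substF-ws (suc k) (suc m) (lift-ws k m sσ) A w

substF-QF : ∀ σ A → QF A → QF (substF σ A)
substF-QF σ (s ≐ t) _ = tt
substF-QF σ (¬' A) q = substF-QF σ A q
substF-QF σ (A ⇒ B) (qA , qB) = substF-QF σ A qA , substF-QF σ B qB

num-ws : ∀ m n → wsT m (num n)
num-ws m zero = tt
num-ws m (suc n) = num-ws m n

substT-num : ∀ σ n → substT σ (num n) ≡ num n
substT-num σ zero = refl
substT-num σ (suc n) = cong sc (substT-num σ n)

mutual
  ⟦substT⟧ : ∀ σ ρ t → ⟦ substT σ t ⟧t ρ ≡ ⟦ t ⟧t (λ i → ⟦ σ i ⟧t ρ)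
  ⟦substT⟧ σ ρ (var i) = refl
  ⟦substT⟧ σ ρ zer = refl
  ⟦substT⟧ σ ρ (sc t) = cong suc (⟦substT⟧ σ ρ t)
  ⟦substT⟧ σ ρ (app f ts) = cong (eval f) (⟦substTs⟧ σ ρ ts)

  ⟦substTs⟧ : ∀ σ ρ {n} (ts : Vec Term n) → ⟦ substTs σ ts ⟧ts ρ ≡ ⟦ ts ⟧ts (λ i → ⟦ σ i ⟧t ρ)
  ⟦substTs⟧ σ ρ [] = refl
  ⟦substTs⟧ σ ρ (t ∷ ts) = cong₂ _∷_ (⟦substT⟧ σ ρ t) (⟦substTs⟧ σ ρ ts)

mutual
  ⟦⟧t-cong : ∀ {ρ ρ′ : ℕ → ℕ} → (∀ i → ρ i ≡ ρ′ i) → ∀ t → ⟦ t ⟧t ρ ≡ ⟦ t ⟧t ρ′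
  ⟦⟧t-cong e (var i) = e i
  ⟦⟧t-cong e zer = refl
  ⟦⟧t-cong e (sc t) = cong suc (⟦⟧t-cong e t)
  ⟦⟧t-cong e (app f ts) = cong (eval f) (⟦⟧ts-cong e ts)

  ⟦⟧ts-cong : ∀ {ρ ρ′ : ℕ → ℕ} → (∀ i → ρ i ≡ ρ′ i) → ∀ {n} (ts : Vec Term n) → ⟦ ts ⟧ts ρ ≡ ⟦ ts ⟧ts ρ′
  ⟦⟧ts-cong e [] = refl
  ⟦⟧ts-cong e (t ∷ ts) = cong₂ _∷_ (⟦⟧t-cong e t) (⟦⟧ts-cong e ts)

⟦num⟧ : ∀ ρ n → ⟦ num n ⟧t ρ ≡ n
⟦num⟧ ρ zero = refl
⟦num⟧ ρ (suc n) = cong suc (⟦num⟧ ρ n)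

Denotes : Sub → (ℕ → ℕ) → (ℕ → ℕ) → Set
Denotes σ ρ ρ′ = ∀ i → ⟦ σ i ⟧t ρ ≡ ρ′ i

lift-denotes : ∀ {σ ρ ρ′} d → Denotes σ ρ ρ′ → Denotes (lift σ) (d ∷ₛ ρ) (d ∷ₛ ρ′)
lift-denotes d e zero = refl
lift-denotes {σ} {ρ} d e (suc i) = trans (⟦substT⟧ (λ j → var (suc j)) (d ∷ₛ ρ) (σ i)) (e i)

⟦substF⟧ : ∀ σ ρ ρ′ → Denotes σ ρ ρ′ → ∀ A → ⟦ substF σ A ⟧ ρ ⇔ ⟦ A ⟧ ρ′
⟦substF⟧ σ ρ ρ′ e (s ≐ t) = mk⇔ (λ p → trans (sym (value s)) (trans p (value t)))
                                 (λ p → trans (value s) (trans p (sym (value t))))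
  where
  value : ∀ u → ⟦ substT σ u ⟧t ρ ≡ ⟦ u ⟧t ρ′
  value u = trans (⟦substT⟧ σ ρ u) (⟦⟧t-cong e u)
⟦substF⟧ σ ρ ρ′ e (¬' A) =
  let open Equivalence (⟦substF⟧ σ ρ ρ′ e A) in mk⇔ (λ ¬a a → ¬a (from a)) (λ ¬a a → ¬a (to a))
⟦substF⟧ σ ρ ρ′ e (A ⇒ B) =
  let module A = Equivalence (⟦substF⟧ σ ρ ρ′ e A) ; module B = Equivalence (⟦substF⟧ σ ρ ρ′ e B) in
  mk⇔ (λ f a → B.to (f (A.from a))) (λ f a → B.from (f (A.to a)))
⟦substF⟧ σ ρ ρ′ e (∀' A) =
  mk⇔ (λ f d → Equivalence.to (under d) (f d)) (λ f d → Equivalence.from (under d) (f d))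
  where
  under : ∀ d → ⟦ substF (lift σ) A ⟧ (d ∷ₛ ρ) ⇔ ⟦ A ⟧ (d ∷ₛ ρ′)
  under d = ⟦substF⟧ (lift σ) (d ∷ₛ ρ) (d ∷ₛ ρ′) (lift-denotes d e) A
⟦substF⟧ σ ρ ρ′ e (∃' A) =
  mk⇔ (λ (d , a) → d , Equivalence.to (under d) a) (λ (d , a) → d , Equivalence.from (under d) a)
  where
  under : ∀ d → ⟦ substF (lift σ) A ⟧ (d ∷ₛ ρ) ⇔ ⟦ A ⟧ (d ∷ₛ ρ′)
  under d = ⟦substF⟧ (lift σ) (d ∷ₛ ρ) (d ∷ₛ ρ′) (lift-denotes d e) A

-- Recognising axioms and proofs

liftⁿ : ℕ → Sub → Sub
liftⁿ zero σ = σ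
liftⁿ (suc k) σ = lift (liftⁿ k σ)

instAt : ℕ → Term → Sub
instAt k u = liftⁿ k (u ∷ₛ var)

wkⁿ : ℕ → Term → Term
wkⁿ zero t = t
wkⁿ (suc k) t = wkT (wkⁿ k t)

instAt-here : ∀ k u → instAt k u k ≡ wkⁿ k u
instAt-here zero u = refl
instAt-here (suc k) u = cong wkT (instAt-here k u)

instAt-elsewhere : ∀ k u i → i ≢ k → Σ ℕ λ j → instAt k u i ≡ var j
instAt-elsewhere zero u zero i≢k = ⊥-elim (i≢k refl)
instAt-elsewhere zero u (suc i) _ = i , refl
instAt-elsewhere (suc k) u zero _ = zero , refl
instAt-elsewhere (suc k) u (suc i) i≢k =
  let (j , e) = instAt-elsewhere k u i (i≢k ∘ cong suc) in suc j , cong wkT e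

instAt-irrelevant : ∀ k u u′ i → i ≢ k → instAt k u i ≡ instAt k u′ i
instAt-irrelevant zero u u′ zero i≢k = ⊥-elim (i≢k refl)
instAt-irrelevant zero u u′ (suc i) _ = refl
instAt-irrelevant (suc k) u u′ zero _ = refl
instAt-irrelevant (suc k) u u′ (suc i) i≢k = cong wkT (instAt-irrelevant k u u′ i (i≢k ∘ cong suc))

skip : ℕ → ℕ → ℕ
skip zero j = suc j
skip (suc k) zero = zero
skip (suc k) (suc j) = suc (skip k j)

instAt-skip : ∀ k u j → instAt k u (skip k j) ≡ var j
instAt-skip zero u j = refl
instAt-skip (suc k) u zero = refl
instAt-skip (suc k) u (suc j) = cong wkT (instAt-skip k u j)

unwkT : Term → Term
unwkT = substT (λ i → var (pred i))

unwkT-wkT : ∀ t → unwkT (wkT t) ≡ t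
unwkT-wkT t = trans (substT-∘ (λ i → var (pred i)) (λ j → var (suc j)) t) (substT-var t)

unwkⁿ : ℕ → Term → Term
unwkⁿ zero t = t
unwkⁿ (suc k) t = unwkⁿ k (unwkT t)

unwkⁿ-wkⁿ : ∀ k t → unwkⁿ k (wkⁿ k t) ≡ t
unwkⁿ-wkⁿ zero t = refl
unwkⁿ-wkⁿ (suc k) t = trans (cong (unwkⁿ k) (unwkT-wkT (wkⁿ k t))) (unwkⁿ-wkⁿ k t)

Found : Term → Maybe Term → Set → Set
Found t m Q = m ≡ just t ⊎ (m ≡ nothing × Q)

found-<∣> : ∀ {t m₁ m₂ Q₁ Q₂} → Found t m₁ Q₁ → Found t m₂ Q₂ → Found t (m₁ <∣> m₂) (Q₁ × Q₂)
found-<∣> (inj₁ refl) _ = inj₁ refl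
found-<∣> (inj₂ (refl , _)) (inj₁ refl) = inj₁ refl
found-<∣> (inj₂ (refl , q₁)) (inj₂ (refl , q₂)) = inj₂ (refl , q₁ , q₂)

found-map : ∀ {t m Q Q′} → (Q → Q′) → Found t m Q → Found t m Q′
found-map f = Sum.map₂ (map₂ f)

-- Reads the substituted term off an instance at the first occurrence of variable k;
-- without an occurrence the instance does not depend on the term.
mutual
  occurrenceT : ℕ → Term → Term → Maybe Term
  occurrenceT k (var i) c with i ≟ k
  ... | yes _ = just (unwkⁿ k c)
  ... | no _ = nothing
  occurrenceT k (sc b) (sc c) = occurrenceT k b c
  occurrenceT k (app {n} f bs) (app {m} g cs) with n ≟ m
  ... | yes refl = occurrenceTs k bs cs
  ... | no _ = nothing
  occurrenceT k _ _ = nothing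

  occurrenceTs : ∀ {n} → ℕ → Vec Term n → Vec Term n → Maybe Term
  occurrenceTs k [] [] = nothing
  occurrenceTs k (b ∷ bs) (c ∷ cs) = occurrenceT k b c <∣> occurrenceTs k bs cs

occurrenceF : ℕ → Formula → Formula → Maybe Term
occurrenceF k (b₁ ≐ b₂) (x₁ ≐ x₂) = occurrenceT k b₁ x₁ <∣> occurrenceT k b₂ x₂
occurrenceF k (¬' B) (¬' X) = occurrenceF k B X
occurrenceF k (B₁ ⇒ B₂) (X₁ ⇒ X₂) = occurrenceF k B₁ X₁ <∣> occurrenceF k B₂ X₂
occurrenceF k (∀' B) (∀' X) = occurrenceF (suc k) B X
occurrenceF k (∃' B) (∃' X) = occurrenceF (suc k) B X
occurrenceF k _ _ = nothing

mutual
  occurrenceT-complete : ∀ k t b → Found t (occurrenceT k b (substT (instAt k t) b))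
                                     (∀ u → substT (instAt k u) b ≡ substT (instAt k t) b)
  occurrenceT-complete k t (var i) with i ≟ k
  ... | yes refl = inj₁ (cong just (trans (cong (unwkⁿ k) (instAt-here k t)) (unwkⁿ-wkⁿ k t)))
  ... | no i≢k = inj₂ (refl , λ u → instAt-irrelevant k u t i i≢k)
  occurrenceT-complete k t zer = inj₂ (refl , λ _ → refl)
  occurrenceT-complete k t (sc b) = found-map (λ q u → cong sc (q u)) (occurrenceT-complete k t b)
  occurrenceT-complete k t (app {n} f bs) rewrite ≟-diag (refl {x = n}) =
    found-map (λ q u → cong (app f) (q u)) (occurrenceTs-complete k t bs)

  occurrenceTs-complete : ∀ {n} k t (bs : Vec Term n) →
    Found t (occurrenceTs k bs (substTs (instAt k t) bs))
          (∀ u → substTs (instAt k u) bs ≡ substTs (instAt k t) bs)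
  occurrenceTs-complete k t [] = inj₂ (refl , λ _ → refl)
  occurrenceTs-complete k t (b ∷ bs) =
    found-map (λ (q , qs) u → cong₂ _∷_ (q u) (qs u))
              (found-<∣> (occurrenceT-complete k t b) (occurrenceTs-complete k t bs))

occurrenceF-complete : ∀ k t B → Found t (occurrenceF k B (substF (instAt k t) B))
                                   (∀ u → substF (instAt k u) B ≡ substF (instAt k t) B)
occurrenceF-complete k t (b₁ ≐ b₂) =
  found-map (λ (q₁ , q₂) u → cong₂ _≐_ (q₁ u) (q₂ u))
            (found-<∣> (occurrenceT-complete k t b₁) (occurrenceT-complete k t b₂))
occurrenceF-complete k t (¬' B) = found-map (λ q u → cong ¬' (q u)) (occurrenceF-complete k t B)
occurrenceF-complete k t (B₁ ⇒ B₂) =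
  found-map (λ (q₁ , q₂) u → cong₂ _⇒_ (q₁ u) (q₂ u))
            (found-<∣> (occurrenceF-complete k t B₁) (occurrenceF-complete k t B₂))
occurrenceF-complete k t (∀' B) = found-map (λ q u → cong ∀' (q u)) (occurrenceF-complete (suc k) t B)
occurrenceF-complete k t (∃' B) = found-map (λ q u → cong ∃' (q u)) (occurrenceF-complete (suc k) t B)

instanceWitness : Formula → Formula → Term
instanceWitness B X = fromMaybe zer (occurrenceF 0 B X)

instanceWitness-correct : ∀ B t → B [ instanceWitness B (B [ t ]) ] ≡ B [ t ]
instanceWitness-correct B t =
  [ at , (λ (e , indep) → trans (at e) (indep zer)) ]′ (occurrenceF-complete 0 t B)
  where
  at : ∀ {m} → occurrenceF 0 B (B [ t ]) ≡ m → B [ instanceWitness B (B [ t ]) ] ≡ B [ fromMaybe zer m ]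
  at e = cong (λ m → B [ fromMaybe zer m ]) e

-- Rebuilds B from B[s] and B[t]: variable k goes wherever the two sides show s and t,
-- elsewhere their common structure is copied.
mutual
  abstractT : ℕ → Term → Term → Term → Term → Term
  abstractT k s t c d with c ≟ₜ wkⁿ k s | d ≟ₜ wkⁿ k t
  ... | yes _ | yes _ = var k
  ... | _ | _ = abstractT′ k s t c d

  abstractT′ : ℕ → Term → Term → Term → Term → Term
  abstractT′ k s t (var j) d = var (skip k j)
  abstractT′ k s t (sc c) (sc d) = sc (abstractT k s t c d)
  abstractT′ k s t (app {n} f cs) (app {m} g ds) with n ≟ m
  ... | yes refl = app f (abstractTs k s t cs ds)
  ... | no _ = zer
  abstractT′ k s t _ _ = zer

  abstractTs : ∀ {n} → ℕ → Term → Term → Vec Term n → Vec Term n → Vec Term n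
  abstractTs k s t [] [] = []
  abstractTs k s t (c ∷ cs) (d ∷ ds) = abstractT k s t c d ∷ abstractTs k s t cs ds

abstractF : ℕ → Term → Term → Formula → Formula → Formula
abstractF k s t (x₁ ≐ x₂) (y₁ ≐ y₂) = abstractT k s t x₁ y₁ ≐ abstractT k s t x₂ y₂
abstractF k s t (¬' X) (¬' Y) = ¬' (abstractF k s t X Y)
abstractF k s t (X₁ ⇒ X₂) (Y₁ ⇒ Y₂) = abstractF k s t X₁ Y₁ ⇒ abstractF k s t X₂ Y₂
abstractF k s t (∀' X) (∀' Y) = ∀' (abstractF (suc k) s t X Y)
abstractF k s t (∃' X) (∃' Y) = ∃' (abstractF (suc k) s t X Y)
abstractF k s t X _ = X

Abstracts : ℕ → Term → Term → Term → Term → Term → Set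
Abstracts k s t a c d = substT (instAt k s) a ≡ c × substT (instAt k t) a ≡ d

mutual
  abstractT-complete : ∀ k s t b → let c = substT (instAt k s) b ; d = substT (instAt k t) b in
                       Abstracts k s t (abstractT k s t c d) c d
  abstractT-complete k s t b with substT (instAt k s) b ≟ₜ wkⁿ k s | substT (instAt k t) b ≟ₜ wkⁿ k t
  ... | yes e₁ | yes e₂ = trans (instAt-here k s) (sym e₁) , trans (instAt-here k t) (sym e₂)
  ... | no ¬e₁ | _ = abstractT′-complete k s t b (¬e₁ ∘ proj₁)
  ... | yes _ | no ¬e₂ = abstractT′-complete k s t b (¬e₂ ∘ proj₂)

  abstractT′-complete : ∀ k s t b → let c = substT (instAt k s) b ; d = substT (instAt k t) b in
                        ¬ (c ≡ wkⁿ k s × d ≡ wkⁿ k t) → Abstracts k s t (abstractT′ k s t c d) c d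
  abstractT′-complete k s t (var i) notHere with i ≟ k
  ... | yes refl = ⊥-elim (notHere (instAt-here k s , instAt-here k t))
  ... | no i≢k with instAt-elsewhere k s i i≢k
  ...   | j , e rewrite instAt-irrelevant k t s i i≢k | e = instAt-skip k s j , instAt-skip k t j
  abstractT′-complete k s t zer _ = refl , refl
  abstractT′-complete k s t (sc b) _ = Product.map (cong sc) (cong sc) (abstractT-complete k s t b)
  abstractT′-complete k s t (app {n} f bs) _ rewrite ≟-diag (refl {x = n}) =
    Product.map (cong (app f)) (cong (app f)) (abstractTs-complete k s t bs)

  abstractTs-complete : ∀ {n} k s t (bs : Vec Term n) →
    substTs (instAt k s) (abstractTs k s t (substTs (instAt k s) bs) (substTs (instAt k t) bs))
      ≡ substTs (instAt k s) bs
    × substTs (instAt k t) (abstractTs k s t (substTs (instAt k s) bs) (substTs (instAt k t) bs))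
      ≡ substTs (instAt k t) bs
  abstractTs-complete k s t [] = refl , refl
  abstractTs-complete k s t (b ∷ bs) =
    let (e₁ , e₂) = abstractT-complete k s t b ; (es₁ , es₂) = abstractTs-complete k s t bs in
    cong₂ _∷_ e₁ es₁ , cong₂ _∷_ e₂ es₂

abstractF-complete : ∀ k s t B → let X = substF (instAt k s) B ; Y = substF (instAt k t) B in
                     substF (instAt k s) (abstractF k s t X Y) ≡ X × substF (instAt k t) (abstractF k s t X Y) ≡ Y
abstractF-complete k s t (b₁ ≐ b₂) =
  let (e₁ , e₂) = abstractT-complete k s t b₁ ; (e₁′ , e₂′) = abstractT-complete k s t b₂ in
  cong₂ _≐_ e₁ e₁′ , cong₂ _≐_ e₂ e₂′
abstractF-complete k s t (¬' B) = Product.map (cong ¬') (cong ¬') (abstractF-complete k s t B)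
abstractF-complete k s t (B₁ ⇒ B₂) =
  let (e₁ , e₂) = abstractF-complete k s t B₁ ; (e₁′ , e₂′) = abstractF-complete k s t B₂ in
  cong₂ _⇒_ e₁ e₁′ , cong₂ _⇒_ e₂ e₂′
abstractF-complete k s t (∀' B) = Product.map (cong ∀') (cong ∀') (abstractF-complete (suc k) s t B)
abstractF-complete k s t (∃' B) = Product.map (cong ∃') (cong ∃') (abstractF-complete (suc k) s t B)

-- For each logical axiom schema, the one instance of it that φ could be
-- (junk where φ has the wrong shape).
axiomCandidates : Formula → List (Σ Formula LogAx)
axiomCandidates φ =
    (case φ of λ { (B ⇒ (X ⇒ _)) → _ , ax1 B X ; _ → junk })
  ∷ (case φ of λ { ((B ⇒ (X ⇒ Y)) ⇒ _) → _ , ax2 B X Y ; _ → junk })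
  ∷ (case φ of λ { ((¬' X ⇒ ¬' B) ⇒ _) → _ , ax3 B X ; _ → junk })
  ∷ (case φ of λ { (∀' B ⇒ X) → _ , ax4 B (instanceWitness B X) ; _ → junk })
  ∷ (case φ of λ { (∀' (_ ⇒ X) ⇒ (B ⇒ _)) → _ , ax5 B X ; _ → junk })
  ∷ (case φ of λ { (X ⇒ ∃' B) → _ , ax6 B (instanceWitness B X) ; _ → junk })
  ∷ (case φ of λ { (∀' (B ⇒ _) ⇒ (_ ⇒ X)) → _ , ax7 B X ; _ → junk })
  ∷ (case φ of λ { (s ≐ _) → _ , eq1 s ; _ → junk })
  ∷ (case φ of λ { ((s ≐ t) ⇒ (X ⇒ Y)) → _ , eq2 (abstractF 0 s t X Y) s t ; _ → junk })
  ∷ []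
  where
  junk : Σ Formula LogAx
  junk = _ , eq1 zer

axiomCandidates-complete : ∀ {φ} → LogAx φ → Any (λ c → proj₁ c ≡ φ) (axiomCandidates φ)
axiomCandidates-complete (ax1 B X) = here refl
axiomCandidates-complete (ax2 B X Y) = there (here refl)
axiomCandidates-complete (ax3 B X) = there (there (here refl))
axiomCandidates-complete (ax4 B t) =
  there (there (there (here (cong (∀' B ⇒_) (instanceWitness-correct B t)))))
axiomCandidates-complete (ax5 B X) = there (there (there (there (here refl))))
axiomCandidates-complete (ax6 B t) =
  there (there (there (there (there (here (cong (_⇒ ∃' B) (instanceWitness-correct B t)))))))
axiomCandidates-complete (ax7 B X) = there (there (there (there (there (there (here refl))))))
axiomCandidates-complete (eq1 t) = there (there (there (there (there (there (there (here refl)))))))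
axiomCandidates-complete (eq2 B s t) =
  let (e₁ , e₂) = abstractF-complete 0 s t B in
  there (there (there (there (there (there (there (there (here
    (cong₂ (λ X Y → (s ≐ t) ⇒ (X ⇒ Y)) e₁ e₂)))))))))

logAx? : ∀ φ → Dec (LogAx φ)
logAx? φ = map′ sound axiomCandidates-complete (any? (λ c → proj₁ c ≟F φ) (axiomCandidates φ))
  where
  sound : Any (λ c → proj₁ c ≡ φ) (axiomCandidates φ) → LogAx φ
  sound found = let ((_ , a) , e) = satisfied found in subst LogAx e a

qf? : ∀ A → Dec (QF A)
qf? (_ ≐ _) = yes tt
qf? (¬' A) = qf? A
qf? (A ⇒ B) = qf? A ×-dec qf? B
qf? (∀' _) = no λ ()
qf? (∃' _) = no λ ()

mutual
  wsT? : ∀ k t → Dec (wsT k t)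
  wsT? k (var i) = i <? k
  wsT? k zer = yes tt
  wsT? k (sc t) = wsT? k t
  wsT? k (app f ts) = wsTs? k ts

  wsTs? : ∀ {n} k (ts : Vec Term n) → Dec (wsTs k ts)
  wsTs? k [] = yes tt
  wsTs? k (t ∷ ts) = wsT? k t ×-dec wsTs? k ts

wsF? : ∀ k A → Dec (wsF k A)
wsF? k (s ≐ t) = wsT? k s ×-dec wsT? k t
wsF? k (¬' A) = wsF? k A
wsF? k (A ⇒ B) = wsF? k A ×-dec wsF? k B
wsF? k (∀' A) = wsF? (suc k) A
wsF? k (∃' A) = wsF? (suc k) A

open import Data.List.Membership.DecPropositional _≟F_ using (_∈?_)

ModusPonens : List Formula → Formula → Set
ModusPonens prev φ = Σ Formula λ ψ → ψ ∈ prev × (ψ ⇒ φ) ∈ prev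

Generalization : List Formula → Formula → Set
Generalization prev φ = Σ Formula λ ψ → φ ≡ ∀' ψ × ψ ∈ prev

modusPonens? : ∀ prev φ → Dec (ModusPonens prev φ)
modusPonens? prev φ = map′ find (λ (_ , ψ∈ , ψ⇒φ∈) → lose ψ∈ ψ⇒φ∈)
                           (any? (λ ψ → (ψ ⇒ φ) ∈? prev) prev)

generalization? : ∀ prev φ → Dec (Generalization prev φ)
generalization? prev (∀' ψ) = map′ (λ ψ∈ → ψ , refl , ψ∈) (λ { (_ , refl , ψ∈) → ψ∈ }) (ψ ∈? prev)
generalization? prev (_ ≐ _) = no λ ()
generalization? prev (¬' _) = no λ ()
generalization? prev (_ ⇒ _) = no λ ()
generalization? prev (∃' _) = no λ ()

module _ (S : Theory) where
  open Theory S

  ax? : ∀ φ → Dec (Ax φ)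
  ax? φ = let (χ , χ-decides) = axPR in
          map′ (proj₂ (χ-decides φ)) (proj₁ (χ-decides φ)) (eval χ (⌜ φ ⌝ ∷ []) ≟ 0)

  step? : ∀ prev φ → Dec (Step S prev φ)
  step? prev φ =
    map′ toStep fromStep (logAx? φ ⊎-dec ax? φ ⊎-dec modusPonens? prev φ ⊎-dec generalization? prev φ)
    where
    toStep : LogAx φ ⊎ Ax φ ⊎ ModusPonens prev φ ⊎ Generalization prev φ → Step S prev φ
    toStep (inj₁ l) = logical l
    toStep (inj₂ (inj₁ a)) = axiom a
    toStep (inj₂ (inj₂ (inj₁ (ψ , ψ∈ , ψ⇒φ∈)))) = mp ψ ψ∈ ψ⇒φ∈
    toStep (inj₂ (inj₂ (inj₂ (ψ , e , ψ∈)))) = gen ψ e ψ∈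

    fromStep : Step S prev φ → LogAx φ ⊎ Ax φ ⊎ ModusPonens prev φ ⊎ Generalization prev φ
    fromStep (logical l) = inj₁ l
    fromStep (axiom a) = inj₂ (inj₁ a)
    fromStep (mp ψ ψ∈ ψ⇒φ∈) = inj₂ (inj₂ (inj₁ (ψ , ψ∈ , ψ⇒φ∈)))
    fromStep (gen ψ e ψ∈) = inj₂ (inj₂ (inj₂ (ψ , e , ψ∈)))

  valid? : ∀ ps → Dec (Valid S ps)
  valid? [] = yes tt
  valid? (φ ∷ ps) = step? ps φ ×-dec valid? ps

-- Derived rules of S

module _ {S : Theory} where
  open Theory S

  ++-valid : ∀ ps qs → Valid S ps → Valid S qs → Valid S (ps ++ qs)
  ++-valid [] qs _ vqs = vqs
  ++-valid (φ ∷ ps) qs (step , vps) vqs = weaken step , ++-valid ps qs vps vqs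
    where
    weaken : Step S ps φ → Step S (ps ++ qs) φ
    weaken (logical l) = logical l
    weaken (axiom a) = axiom a
    weaken (mp ψ ψ∈ ψ⇒φ∈) = mp ψ (∈-++⁺ˡ ψ∈) (∈-++⁺ˡ ψ⇒φ∈)
    weaken (gen ψ e ψ∈) = gen ψ e (∈-++⁺ˡ ψ∈)

  valid⇒prov : ∀ {φ} ps → Valid S (φ ∷ ps) → Prov S φ
  valid⇒prov {φ} ps v = ⌜ φ ∷ ps ⌝l , ps , v , refl

  logical-prov : ∀ {φ} → LogAx φ → Prov S φ
  logical-prov l = valid⇒prov [] (logical l , tt)

  mp-prov : ∀ {ψ φ} → Prov S ψ → Prov S (ψ ⇒ φ) → Prov S φ
  mp-prov {ψ} {φ} (_ , ps , vps , _) (_ , qs , vqs , _) =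
    valid⇒prov ((ψ ∷ ps) ++ ((ψ ⇒ φ) ∷ qs))
      (mp ψ (here refl) (∈-++⁺ʳ (ψ ∷ ps) (here refl)) , ++-valid (ψ ∷ ps) ((ψ ⇒ φ) ∷ qs) vps vqs)

  gen-prov : ∀ {ψ} → Prov S ψ → Prov S (∀' ψ)
  gen-prov {ψ} (_ , ps , v , _) = valid⇒prov (ψ ∷ ps) (gen ψ refl (here refl) , v)

  data _⊢_ (Γ : List Formula) : Formula → Set where
    hyp : ∀ {φ} → φ ∈ Γ → Γ ⊢ φ
    thm : ∀ {φ} → Prov S φ → Γ ⊢ φ
    mpᵈ : ∀ {ψ φ} → Γ ⊢ ψ → Γ ⊢ (ψ ⇒ φ) → Γ ⊢ φ

  axᵈ : ∀ {Γ φ} → LogAx φ → Γ ⊢ φ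
  axᵈ = thm ∘ logical-prov

  weakenᵈ : ∀ {Γ B} A → Γ ⊢ B → Γ ⊢ (A ⇒ B)
  weakenᵈ {B = B} A d = mpᵈ d (axᵈ (ax1 B A))

  ⇒-refl : ∀ A → Prov S (A ⇒ A)
  ⇒-refl A = mp-prov (logical-prov (ax1 A A))
               (mp-prov (logical-prov (ax1 A (A ⇒ A))) (logical-prov (ax2 A (A ⇒ A) A)))

  deduction : ∀ {Γ A B} → (A ∷ Γ) ⊢ B → Γ ⊢ (A ⇒ B)
  deduction {A = A} (hyp (here refl)) = thm (⇒-refl A)
  deduction {A = A} (hyp (there B∈)) = weakenᵈ A (hyp B∈)
  deduction {A = A} (thm p) = weakenᵈ A (thm p)
  deduction {A = A} {B} (mpᵈ {ψ} d₁ d₂) = mpᵈ (deduction d₁) (mpᵈ (deduction d₂) (axᵈ (ax2 A ψ B)))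

  closed : ∀ {φ} → [] ⊢ φ → Prov S φ
  closed (thm p) = p
  closed (mpᵈ d₁ d₂) = mp-prov (closed d₁) (closed d₂)

  hyp₀ : ∀ {Γ φ} → (φ ∷ Γ) ⊢ φ
  hyp₀ = hyp (here refl)

  ¬¬-elim : ∀ B → Prov S (¬' (¬' B) ⇒ B)
  ¬¬-elim B = closed (deduction (mpᵈ (thm (⇒-refl (¬' B))) (mpᵈ (weakenᵈ (¬' B) hyp₀) (axᵈ (ax3 (¬' B) B)))))

  contraposeˡ : ∀ {B X} → Prov S (¬' B ⇒ X) → Prov S (¬' X ⇒ B)
  contraposeˡ {B} {X} p = closed (deduction (mpᵈ (thm p) (mpᵈ (weakenᵈ (¬' B) hyp₀) (axᵈ (ax3 X B)))))

  contrapose : ∀ {B X} → Prov S (B ⇒ X) → Prov S (¬' X ⇒ ¬' B)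
  contrapose {B} {X} p = closed (deduction (mpᵈ ¬¬B⇒X (mpᵈ (weakenᵈ (¬' (¬' B)) hyp₀) (axᵈ (ax3 X (¬' B))))))
    where
    ¬¬B⇒X : (¬' X ∷ []) ⊢ (¬' (¬' B) ⇒ X)
    ¬¬B⇒X = deduction (mpᵈ (mpᵈ hyp₀ (thm (¬¬-elim B))) (thm p))

  ⇒-trans : ∀ {A B X} → Prov S (A ⇒ B) → Prov S (B ⇒ X) → Prov S (A ⇒ X)
  ⇒-trans p q = closed (deduction (mpᵈ (mpᵈ hyp₀ (thm p)) (thm q)))

  explosion : ∀ {A B} → Prov S A → Prov S (¬' A) → Prov S B
  explosion {A} {B} p ¬p = mp-prov p (mp-prov ¬p ¬A⇒A⇒B)
    where
    ¬A⇒A⇒B : Prov S (¬' A ⇒ (A ⇒ B))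
    ¬A⇒A⇒B = closed (deduction (deduction
      (mpᵈ (weakenᵈ (¬' B) hyp₀) (mpᵈ (weakenᵈ (¬' B) (hyp (there (here refl)))) (axᵈ (ax3 A B))))))

  ∀-intro : ∀ {B X} → Prov S (wkF B ⇒ X) → Prov S (B ⇒ ∀' X)
  ∀-intro {B} {X} p = mp-prov (gen-prov p) (logical-prov (ax5 B X))

  ∃-elim : ∀ {B X} → Prov S (∃' B) → Prov S (B ⇒ wkF X) → Prov S X
  ∃-elim {B} {X} p q = mp-prov p (mp-prov (gen-prov q) (logical-prov (ax7 B X)))

  ∃-intro : ∀ {B} t → Prov S (B [ t ]) → Prov S (∃' B)
  ∃-intro {B} t p = mp-prov p (logical-prov (ax6 B t))

  ∃-intro₀ : ∀ {B} → wsF 1 B → Prov S (B ⇒ ∃' B)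
  ∃-intro₀ {B} w = subst (λ B′ → Prov S (B′ ⇒ ∃' B)) (substF-idBelow 1 var0 B w) (logical-prov (ax6 B (var 0)))
    where
    var0 : IdBelow 1 (var 0 ∷ₛ var)
    var0 zero _ = refl
    var0 (suc i) (s≤s ())

  ¬∀⇒∃¬ : ∀ {K} → wsF 1 K → Prov S (¬' (∀' K)) → Prov S (∃' (¬' K))
  ¬∀⇒∃¬ {K} w p = mp-prov p (contraposeˡ (∀-intro ¬∃¬K⇒K))
    where
    ¬∃¬K⇒K : Prov S (wkF (¬' (∃' (¬' K))) ⇒ K)
    ¬∃¬K⇒K = subst (λ X → Prov S (X ⇒ K)) (sym (wkF-sentence (¬' (∃' (¬' K))) w)) (contraposeˡ (∃-intro₀ w))

  ¬∃⇒∀¬ : ∀ H → Prov S (¬' (∃' H) ⇒ ∀' (¬' H))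
  ¬∃⇒∀¬ H = ∀-intro (contrapose H⇒∃H)
    where
    H↑ : Formula
    H↑ = substF (lift (λ j → var (suc j))) H

    H↑[var0] : H↑ [ var 0 ] ≡ H
    H↑[var0] = begin
      H↑ [ var 0 ]                                       ≡⟨ substF-∘ _ _ H ⟩
      substF ((var 0 ∷ₛ var) ∘ₛ lift (λ j → var (suc j))) H ≡⟨ substF-cong (λ { zero → refl ; (suc _) → refl }) H ⟩
      substF var H                                       ≡⟨ substF-var H ⟩
      H                                                  ∎
      where open ≡-Reasoning

    H⇒∃H : Prov S (H ⇒ wkF (∃' H))
    H⇒∃H = subst (λ H′ → Prov S (H′ ⇒ wkF (∃' H))) H↑[var0] (logical-prov (ax6 H↑ (var 0)))

  ∃¬∃⇒∃∀¬ : ∀ {H} → wsF 2 H → Prov S (∃' (¬' (∃' H))) → Prov S (∃' (∀' (¬' H)))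
  ∃¬∃⇒∃∀¬ {H} w p = ∃-elim p (subst (λ X → Prov S (¬' (∃' H) ⇒ X)) (sym (wkF-sentence G w))
                                      (⇒-trans (¬∃⇒∀¬ H) (∃-intro₀ w)))
    where
    G : Formula
    G = ∃' (∀' (¬' H))

  -- 1-consistency applies to ∃v φ, with v vacuous.
  qf-sound : OneConsistent S → ∀ {φ} → QF φ → Sentence φ → Prov S φ → TrueN φ
  qf-sound oc {φ} q w p =
    let (d , t) = oc (wkF φ) (substF-QF _ φ q) (substF-ws 0 1 (λ _ ()) φ w) (mp-prov p φ⇒∃φ)
    in Equivalence.to (⟦substF⟧ (λ j → var (suc j)) (d ∷ₛ (λ _ → 0)) (λ _ → 0) (λ _ → refl) φ) t
    where
    φ⇒∃φ : Prov S (φ ⇒ ∃' (wkF φ))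
    φ⇒∃φ = subst (λ X → Prov S (X ⇒ ∃' (wkF φ))) (trans (substF-∘ _ _ φ) (substF-var φ))
                 (logical-prov (ax6 (wkF φ) zer))

  twoConsistent⇒consistent : TwoConsistent S → ¬ Inconsistent S
  twoConsistent⇒consistent tc (φ , p , ¬p) =
    let (_ , never) = tc (¬' (zer ≐ zer)) tt (tt , tt) (explosion p ¬p) in never 0 refl

-- Numerals in Gödel numbers

<-pairˡ : ∀ {n a} b → n < a → n < pair a b
<-pairˡ {a = a} b n<a = <-trans n<a (fst<pair a b)

<-pairʳ : ∀ {n b} a → n < b → n < pair a b
<-pairʳ {b = b} a n<b = <-trans n<b (snd<pair a b)

mutual
  ⌜⌝t-wkT : ∀ t → ⌜ t ⌝t ≤ ⌜ wkT t ⌝t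
  ⌜⌝t-wkT (var i) = pair-mono-≤ {0} ≤-refl (n≤1+n i)
  ⌜⌝t-wkT zer = ≤-refl
  ⌜⌝t-wkT (sc t) = pair-mono-≤ {2} ≤-refl (⌜⌝t-wkT t)
  ⌜⌝t-wkT (app f ts) = pair-mono-≤ {3} ≤-refl (pair-mono-≤ {⌜ f ⌝pr} ≤-refl (⌜⌝ts-wkTs ts))

  ⌜⌝ts-wkTs : ∀ {n} (ts : Vec Term n) → ⌜ ts ⌝ts ≤ ⌜ substTs (λ j → var (suc j)) ts ⌝ts
  ⌜⌝ts-wkTs [] = ≤-refl
  ⌜⌝ts-wkTs (t ∷ ts) = pair-mono-≤ (⌜⌝t-wkT t) (⌜⌝ts-wkTs ts)

IndexBelowCode : (ℕ → Sub) → Set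
IndexBelowCode σ = ∀ n i → σ n i ≡ σ 0 i ⊎ n < ⌜ σ n i ⌝t

lift-indexBelowCode : ∀ {σ} → IndexBelowCode σ → IndexBelowCode (λ n → lift (σ n))
lift-indexBelowCode g n zero = inj₁ refl
lift-indexBelowCode {σ} g n (suc i) =
  Sum.map (cong wkT) (λ n<code → <-≤-trans n<code (⌜⌝t-wkT (σ n i))) (g n i)

mutual
  substT-indexBelowCode : ∀ {σ} → IndexBelowCode σ → ∀ n t →
                          substT (σ n) t ≡ substT (σ 0) t ⊎ n < ⌜ substT (σ n) t ⌝t
  substT-indexBelowCode g n (var i) = g n i
  substT-indexBelowCode g n zer = inj₁ refl
  substT-indexBelowCode g n (sc t) = Sum.map (cong sc) (<-pairʳ 2) (substT-indexBelowCode g n t)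
  substT-indexBelowCode {σ} g n (app f ts) =
    Sum.map (cong (app f)) (<-pairʳ 3 ∘ <-pairʳ ⌜ f ⌝pr) (substTs-indexBelowCode g n ts)

  substTs-indexBelowCode : ∀ {σ} → IndexBelowCode σ → ∀ n {m} (ts : Vec Term m) →
                           substTs (σ n) ts ≡ substTs (σ 0) ts ⊎ n < ⌜ substTs (σ n) ts ⌝ts
  substTs-indexBelowCode g n [] = inj₁ refl
  substTs-indexBelowCode {σ} g n (t ∷ ts) with substT-indexBelowCode g n t | substTs-indexBelowCode g n ts
  ... | inj₁ e | inj₁ es = inj₁ (cong₂ _∷_ e es)
  ... | inj₂ lt | _ = inj₂ (<-pairˡ ⌜ substTs (σ n) ts ⌝ts lt)
  ... | inj₁ _ | inj₂ lt = inj₂ (<-pairʳ ⌜ substT (σ n) t ⌝t lt)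

substF-indexBelowCode : ∀ {σ} → IndexBelowCode σ → ∀ n A →
                        substF (σ n) A ≡ substF (σ 0) A ⊎ n < ⌜ substF (σ n) A ⌝
substF-indexBelowCode {σ} g n (s ≐ t) with substT-indexBelowCode g n s | substT-indexBelowCode g n t
... | inj₁ e | inj₁ e′ = inj₁ (cong₂ _≐_ e e′)
... | inj₂ lt | _ = inj₂ (<-pairʳ 0 (<-pairˡ ⌜ substT (σ n) t ⌝t lt))
... | inj₁ _ | inj₂ lt = inj₂ (<-pairʳ 0 (<-pairʳ ⌜ substT (σ n) s ⌝t lt))
substF-indexBelowCode g n (¬' A) = Sum.map (cong ¬') (<-pairʳ 1) (substF-indexBelowCode g n A)
substF-indexBelowCode {σ} g n (A ⇒ B) with substF-indexBelowCode g n A | substF-indexBelowCode g n B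
... | inj₁ e | inj₁ e′ = inj₁ (cong₂ _⇒_ e e′)
... | inj₂ lt | _ = inj₂ (<-pairʳ 2 (<-pairˡ ⌜ substF (σ n) B ⌝ lt))
... | inj₁ _ | inj₂ lt = inj₂ (<-pairʳ 2 (<-pairʳ ⌜ substF (σ n) A ⌝ lt))
substF-indexBelowCode g n (∀' A) =
  Sum.map (cong ∀') (<-pairʳ 3) (substF-indexBelowCode (lift-indexBelowCode g) n A)
substF-indexBelowCode g n (∃' A) =
  Sum.map (cong ∃') (<-pairʳ 4) (substF-indexBelowCode (lift-indexBelowCode g) n A)

n<⌜num⌝ : ∀ n → n < ⌜ num n ⌝t
n<⌜num⌝ zero = 0<pair 1 0
n<⌜num⌝ (suc n) = <-≤-trans (s≤s (n<⌜num⌝ n)) (snd<pair 2 ⌜ num n ⌝t)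

-- The standing assumption on the Gödel numbering: a formula containing n̄ has a code above n.
sub2-index<code : ∀ A x n → sub2 A x n ≡ sub2 A x 0 ⊎ n < ⌜ sub2 A x n ⌝
sub2-index<code A x n = substF-indexBelowCode numeralAt0 n A
  where
  numeralAt0 : IndexBelowCode (λ m → num m ∷ₛ (num x ∷ₛ var))
  numeralAt0 m zero = inj₂ (n<⌜num⌝ m)
  numeralAt0 m (suc i) = inj₁ refl

-- Witnesses for H

⟦sub2⟧ : ∀ A x n → TrueN (sub2 A x n) ⇔ ⟦ A ⟧ (n ∷ₛ (x ∷ₛ (λ _ → 0)))
⟦sub2⟧ A x n = ⟦substF⟧ _ _ _ numerals A
  where
  numerals : Denotes (num n ∷ₛ (num x ∷ₛ var)) (λ _ → 0) (n ∷ₛ (x ∷ₛ (λ _ → 0)))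
  numerals zero = ⟦num⟧ _ n
  numerals (suc zero) = ⟦num⟧ _ x
  numerals (suc (suc i)) = refl

sub2-sentence : ∀ A x n → wsF 2 A → Sentence (sub2 A x n)
sub2-sentence A x n = substF-ws 2 0 numerals A
  where
  numerals : ScopedBelow 2 0 (num n ∷ₛ (num x ∷ₛ var))
  numerals zero _ = num-ws 0 n
  numerals (suc zero) _ = num-ws 0 x
  numerals (suc (suc i)) (s≤s (s≤s ()))

module _ {S : Theory} (qfComplete : QFComplete S) where

  Π₂-instance : Inconsistent S ⊎ OneConsistent S → ∀ {A} → QF A → wsF 2 A →
                Prov S (∀' (∃' A)) → ∀ x → Σ ℕ λ n → Prov S (sub2 A x n)
  Π₂-instance (inj₁ (φ , p , ¬p)) q w _ x = 0 , explosion p ¬p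
  Π₂-instance (inj₂ oc) {A} q w p x =
    let (n , t) = oc A[x] (substF-QF _ A q) (substF-ws 2 1 scoped A w)
                     (mp-prov p (logical-prov (ax4 (∃' A) (num x))))
        true-instance = Equivalence.from (⟦sub2⟧ A x n) (Equivalence.to (⟦substF⟧ _ _ _ (denotes n) A) t)
    in n , qfComplete (sub2 A x n) (substF-QF _ A q) (sub2-sentence A x n w) true-instance
    where
    A[x] : Formula
    A[x] = substF (lift (num x ∷ₛ var)) A

    scoped : ScopedBelow 2 1 (lift (num x ∷ₛ var))
    scoped zero _ = s≤s z≤n
    scoped (suc zero) _ = wkT-ws 0 (num x) (num-ws 0 x)
    scoped (suc (suc i)) (s≤s (s≤s ()))

    denotes : ∀ n → Denotes (lift (num x ∷ₛ var)) (n ∷ₛ (λ _ → 0)) (n ∷ₛ (x ∷ₛ (λ _ → 0)))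
    denotes n zero = refl
    denotes n (suc zero) = trans (⟦substT⟧ (λ j → var (suc j)) _ (num x)) (⟦num⟧ _ x)
    denotes n (suc (suc i)) = refl

claimedΠ₂ : Maybe (List Formula) → Maybe (Formula × List Formula)
claimedΠ₂ (just (∀' (∃' A) ∷ ps)) = just (A , ps)
claimedΠ₂ _ = nothing

module _ (S : Theory) where

  data Reading (x : ℕ) : Set where
    Π₂-proof : ∀ A → QF A → wsF 2 A → Prov S (∀' (∃' A)) →
               (∀ {A′} → PrfS S x (∀' (∃' A′)) → A′ ≡ A) → Reading x
    no-Π₂-proof : (∀ A → QF A → wsF 2 A → ¬ PrfS S x (∀' (∃' A))) → Reading x

  PrfS-claimed : ∀ {x A} → PrfS S x (∀' (∃' A)) →
                 Σ (List Formula) λ ps → Valid S (∀' (∃' A) ∷ ps) × claimedΠ₂ (decode x) ≡ just (A , ps)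
  PrfS-claimed {A = A} (ps , v , refl) = ps , v , cong claimedΠ₂ (decode-⌜⌝ (∀' (∃' A) ∷ ps))

  read : ∀ x → Reading x
  read x with claimedΠ₂ (decode x) in claim
  ... | nothing = no-Π₂-proof λ A _ _ prf → case trans (sym claim) (proj₂ (proj₂ (PrfS-claimed prf))) of λ ()
  ... | just (A , ps) with qf? A ×-dec wsF? 2 A ×-dec valid? S (∀' (∃' A) ∷ ps)
  ...   | yes (q , w , v) = Π₂-proof A q w (valid⇒prov ps v) λ prf →
            case trans (sym claim) (proj₂ (proj₂ (PrfS-claimed prf))) of λ { refl → refl }
  ...   | no invalid = no-Π₂-proof λ A′ q w prf → let (_ , v , claim′) = PrfS-claimed prf in
            case trans (sym claim) claim′ of λ { refl → invalid (q , w , v) }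

H-witness : ∀ {S} → QFComplete S → Inconsistent S ⊎ OneConsistent S → ∀ x → Σ ℕ (HRel S x)
H-witness {S} qfComplete incons⊎1cons x with read S x
... | no-Π₂-proof none = 0 , λ A q w prf → ⊥-elim (none A q w prf)
... | Π₂-proof A q w p unique =
  let (n , y , prf) = Π₂-instance qfComplete incons⊎1cons q w p x in
  y , λ A′ _ _ prf′ → case unique prf′ of λ { refl → n , prf }

-- The sentence Θ

∃H≡∃H[num] : ∀ H n → ∃H H n ≡ (∃' H) [ num n ]
∃H≡∃H[num] H n = cong ∃' (substF-cong numeral H)
  where
  numeral : ∀ i → (var 0 ∷ₛ (num n ∷ₛ (λ j → var (suc j)))) i ≡ lift (num n ∷ₛ var) i
  numeral zero = refl
  numeral (suc zero) = sym (substT-num _ n)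
  numeral (suc (suc i)) = refl

module Θ-properties (S : Theory) (qfComplete : QFComplete S) (H : Formula) (expresses : Expresses S H)
                    (incons⊎1cons : Inconsistent S ⊎ OneConsistent S) where

  qfH : QF H
  qfH = proj₁ expresses

  wsH : wsF 2 H
  wsH = proj₁ (proj₂ expresses)

  H↔HRel : ∀ x y → (TrueN (sub2 H x y) → HRel S x y) × (HRel S x y → TrueN (sub2 H x y))
  H↔HRel = proj₂ (proj₂ expresses)

  Θ-true : TrueN (Θ H)
  Θ-true x = let (y , hrel) = H-witness qfComplete incons⊎1cons x in
             y , Equivalence.to (⟦sub2⟧ H x y) (proj₂ (H↔HRel x y) hrel)

  ∃H-provable : ∀ m → Prov S (∃H H m)
  ∃H-provable m =
    let (y , t) = Θ-true m
        instance-provable = qfComplete (sub2 H m y) (substF-QF _ H qfH) (sub2-sentence H m y wsH)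
                                       (Equivalence.from (⟦sub2⟧ H m y) t)
    in ∃-intro (num y) (subst (Prov S) (sym (instance≡ y)) instance-provable)
    where
    instance≡ : ∀ y → substF (var 0 ∷ₛ (num m ∷ₛ (λ j → var (suc j)))) H [ num y ] ≡ sub2 H m y
    instance≡ y = trans (substF-∘ _ _ H) (substF-cong numerals H)
      where
      numerals : ∀ i → ((num y ∷ₛ var) ∘ₛ (var 0 ∷ₛ (num m ∷ₛ (λ j → var (suc j))))) i ≡ (num y ∷ₛ (num m ∷ₛ var)) i
      numerals zero = refl
      numerals (suc zero) = substT-num _ m
      numerals (suc (suc i)) = refl

  ¬Θ-unprovable-ω : OmegaConsistent S → ¬ Prov S (¬' (Θ H))
  ¬Θ-unprovable-ω ωc p =
    ωc (∃' H) wsH (¬∀⇒∃¬ wsH p , λ n → subst (Prov S) (∃H≡∃H[num] H n) (∃H-provable n))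

  ¬Θ-unprovable-2 : TwoConsistent S → ¬ Prov S (¬' (Θ H))
  ¬Θ-unprovable-2 tc p =
    let (x , ¬H) = tc (¬' H) qfH wsH (∃¬∃⇒∃∀¬ wsH (¬∀⇒∃¬ wsH p)) ; (y , h) = Θ-true x in ¬H y h

  Θ-unprovable : TwoConsistent S → ¬ Prov S (Θ H)
  Θ-unprovable tc (x , prf) =
    let (y , h) = Θ-true x in descent∧wf⇒empty descent <-wellFounded y (Equivalence.from (⟦sub2⟧ H x y) h)
    where
    oc : OneConsistent S
    oc = fromInj₂ (⊥-elim ∘ twoConsistent⇒consistent tc) incons⊎1cons

    descent : Descent _<_ (λ y → TrueN (sub2 H x y))
    descent {y} t with proj₁ (H↔HRel x y) t H qfH wsH prf
    ... | n , ps , v , refl = smaller (sub2-index<code H x n)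
      where
      true-n : TrueN (sub2 H x n)
      true-n = qf-sound oc (substF-QF _ H qfH) (sub2-sentence H x n wsH) (valid⇒prov ps v)

      smaller : sub2 H x n ≡ sub2 H x 0 ⊎ n < ⌜ sub2 H x n ⌝ →
                Σ ℕ λ y′ → y′ < ⌜ sub2 H x n ∷ ps ⌝l × TrueN (sub2 H x y′)
      smaller (inj₁ e) = 0 , 0<pair ⌜ sub2 H x n ⌝ ⌜ ps ⌝l , subst TrueN e true-n
      smaller (inj₂ n<code) = n , <-pairˡ ⌜ ps ⌝l n<code , true-n

mainTheorem2 : (S : Theory) → QFComplete S → (H : Formula) → Expresses S H →
    (Inconsistent S ⊎ OneConsistent S) →
    TrueN (Θ H)
    × ((m : ℕ) → Prov S (∃H H m))
    × (OmegaConsistent S → ¬ Prov S (¬' (Θ H)))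
    × (TwoConsistent S → ¬ Prov S (¬' (Θ H)))
    × (TwoConsistent S → ¬ Prov S (Θ H) × ¬ Prov S (¬' (Θ H)))
mainTheorem2 S qfComplete H expresses incons⊎1cons =
  Θ-true , ∃H-provable , ¬Θ-unprovable-ω , ¬Θ-unprovable-2 , λ tc → Θ-unprovable tc , ¬Θ-unprovable-2 tc
  where open Θ-properties S qfComplete H expresses incons⊎1cons
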